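{- Let $G$ be a graph and $k\geq 1$ an integer. If $G$ does not contain $\theta_{k+1}$ as an immersion, then $\delta_{\rm e}^{\infty}(G)\leq 2k-1$.
   Context: Graphs are finite, undirected, loopless, possibly with parallel edges. $\theta_r$ is the graph with two vertices and $r$ parallel edges. Lifting two edges $ua,ub$ ($a\neq b$) means replacing them by an edge $ab$; $H$ is an immersion of $G$ if a graph isomorphic to $H$ can be obtained from a subgraph of $G$ by liftings. For $x\in V(G)$ and $S\subseteq V(G)\setminus\{x\}$, ${\bf supp}_G(x,S)$ is the minimum size of a set $A\subseteq E(G)$ (with multiplicity) such that every path from $x$ to a vertex of $S$ contains an edge of $A$ ($0$ if $S=\emptyset$). For a layout $L=\langle v_1,\dots,v_n\rangle$ of $V(G)$ its value is $\max_i{\bf supp}_G(v_i,\{v_1,\dots,v_{i-1}\})$, and $\delta_{\rm e}^{\infty}(G)$ (edge-admissibility) is the minimum value over all layouts. -}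

module Defs where

open import Data.Nat using (ℕ; zero; suc; _≤_; _<_)
open import Data.Fin using (Fin; zero; suc; _≟_) renaming (_<_ to _<ᶠ_)
open import Data.Sum using (_⊎_)
open import Relation.Nullary using (Dec; yes; no)
open import Relation.Nullary.Decidable using (_×-dec_; _⊎-dec_)
open import Data.Fin.Subset using (Subset; _∉_; ∣_∣)
open import Data.Fin.Permutation using (Permutation′; _⟨$⟩ʳ_)
open import Data.Product using (Σ; _×_; _,_; proj₁; proj₂; ∃; ∃-syntax)
open import Data.List using (List; []; _∷_; length; lookup; replicate)
open import Data.List.Relation.Unary.All using (All; []; _∷_)
open import Data.List.Relation.Binary.Permutation.Propositional using (_↭_)
open import Relation.Binary.Construct.Closure.ReflexiveTransitive using (Star)
open import Relation.Binary.PropositionalEquality using (_≡_; _≢_)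
open import Relation.Nullary using (¬_)

-- Vertices are Fin n; the edges form a
-- list of (unordered) pairs of distinct vertices; an edge (u , v) is the
-- same as an edge (v , u).  Parallel edges are distinct list entries.

Edge : ℕ → Set
Edge n = Fin n × Fin n

record Graph : Set where
  field
    n        : ℕ
    edges    : List (Edge n)
    loopless : All (λ e → proj₁ e ≢ proj₂ e) edges
open Graph public

Joins : ∀ {n} → Edge n → Fin n → Fin n → Set
Joins (u , v) x y = (u ≡ x × v ≡ y) ⊎ (u ≡ y × v ≡ x)

joins? : ∀ {n} (e : Edge n) (x y : Fin n) → Dec (Joins e x y)
joins? (u , v) x y = ((u ≟ x) ×-dec (v ≟ y)) ⊎-dec ((u ≟ y) ×-dec (v ≟ x))

θ-edge : Edge 2
θ-edge = (zero , suc zero)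

θ-loopless : (r : ℕ) → All (λ (e : Edge 2) → proj₁ e ≢ proj₂ e) (replicate r θ-edge)
θ-loopless zero = []
θ-loopless (suc r) = (λ ()) ∷ θ-loopless r

θ : ℕ → Graph
θ r = record { n = 2 ; edges = replicate r θ-edge ; loopless = θ-loopless r }

data Step {n : ℕ} : List (Edge n) → List (Edge n) → Set where
  delete : ∀ {E} (e : Edge n) (rest : List (Edge n)) →
           E ↭ (e ∷ rest) → Step E rest
  lift   : ∀ {E} (e₁ e₂ : Edge n) (rest : List (Edge n)) (u a b : Fin n) →
           E ↭ (e₁ ∷ e₂ ∷ rest) → Joins e₁ u a → Joins e₂ u b → a ≢ b →
           Step E ((a , b) ∷ rest)

mult : ∀ {n} → List (Edge n) → Fin n → Fin n → ℕ
mult [] x y = 0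
mult (e ∷ E) x y with joins? e x y
... | yes _ = suc (mult E x y)
... | no  _ = mult E x y

-- H is an immersion of G: from the edge multiset of G, by edge deletions
-- and liftings, we reach an edge multiset E' and an injective vertex map
-- f : V(H) → V(G) such that E' has exactly the edges of H transported
-- along f (edge multiplicities agree, and every edge of E' has both ends
-- in the image of f; the remaining vertices are isolated and deleted).
Immersion : Graph → Graph → Set
Immersion H G =
  Σ (List (Edge (n G))) λ E' → Star Step (edges G) E' ×
  Σ (Fin (n H) → Fin (n G)) λ f → (∀ i j → f i ≡ f j → i ≡ j) ×
         (∀ x y → mult (edges H) x y ≡ mult E' (f x) (f y)) ×
         All (λ e → (∃[ i ] f i ≡ proj₁ e) × (∃[ j ] f j ≡ proj₂ e)) E'

data Conn (G : Graph) (A : Subset (length (edges G))) : Fin (n G) → Fin (n G) → Set where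
  here : ∀ {x} → Conn G A x x
  fwd  : ∀ {u w y} (e : Fin (length (edges G))) → e ∉ A →
         lookup (edges G) e ≡ (u , w) → Conn G A w y → Conn G A u y
  bwd  : ∀ {u w y} (e : Fin (length (edges G))) → e ∉ A →
         lookup (edges G) e ≡ (w , u) → Conn G A w y → Conn G A u y

SuppAtMost : (G : Graph) → Fin (n G) → (Fin (n G) → Set) → ℕ → Set
SuppAtMost G x S c =
  ∃[ A ] ∣ A ∣ ≤ c × (∀ y → S y → ¬ Conn G A x y)

-- A layout is a permutation L of V(G); v_i = L ⟨$⟩ʳ i.
Layout : Graph → Set
Layout G = Permutation′ (n G)

LayoutValueAtMost : (G : Graph) → Layout G → ℕ → Set
LayoutValueAtMost G L c =
  ∀ i → SuppAtMost G (L ⟨$⟩ʳ i) (λ v → ∃[ j ] (j <ᶠ i × L ⟨$⟩ʳ j ≡ v)) c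

EdgeAdmAtMost : Graph → ℕ → Set
EdgeAdmAtMost G c = ∃[ L ] LayoutValueAtMost G L c

-- If G has no immersion of θ (k + 1), any two distinct vertices are separated by at most k edges:
-- otherwise, by max-flow/min-cut, there is a unit flow of value k + 1 between them, and
-- lifting consecutive arcs of that flow at inner vertices turns it into k + 1 parallel edges.
-- By submodularity of the edge boundary, minimum cuts can be uncrossed, so every nonempty
-- set R of vertices has a vertex v cut off from the rest of R by at most k edges. Peeling
-- such vertices off one at a time and laying them out in reverse order gives a layout of
-- value at most k ≤ 2k − 1.

module Submission where

open import Defs
open import Data.Nat using (ℕ; zero; suc; _+_; _*_; _∸_; _≤_; _<_; z≤n; s≤s)
open import Data.Nat.Properties hiding (_≟_)
open import Data.Nat.Induction using (<-wellFounded)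
open import Data.Nat.Tactic.RingSolver using (solve-∀)
import Data.Nat.ListAction as ℕᴸ
import Data.Nat.ListAction.Properties as ℕᴸ
open import Algebra.Properties.Semiring.Sum +-*-semiring
  using (sum; sum-cong-≗; ∑-distrib-+; ∑-comm; *-distribˡ-sum)
open import Data.Bool using (Bool; true; false; _∧_; _∨_; not; _xor_)
open import Data.Bool.Properties using (∧-identityʳ; ∧-zeroʳ; ∨-zeroʳ; not-involutive)
open import Data.Fin using (Fin; zero; suc; _≟_; opposite; punchOut) renaming (_<_ to _<ᶠ_)
import Data.Fin.Properties as Fin
open import Data.Fin.Subset using (_∉_; ∣_∣)
open import Data.Fin.Permutation using (permutation)
open import Data.Product using (Σ; _×_; _,_; proj₁; proj₂; ∃-syntax)
open import Data.Sum using (_⊎_; inj₁; inj₂)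
open import Data.Unit using (tt)
open import Data.Vec using (tabulate)
open import Data.Vec.Properties using (lookup∘tabulate; lookup⇒[]=)
open import Data.Vec.Functional using (updateAt)
open import Data.Vec.Functional.Properties using (updateAt-updates; updateAt-minimal)
open import Data.List using (List; []; _∷_; _++_; length; lookup; map; replicate)
open import Data.List.Properties using (++-identityʳ; map-++; length-map)
open import Data.List.Relation.Unary.All as All using (All; []; _∷_)
open import Data.List.Relation.Unary.All.Properties using (++⁻ˡ) renaming (map⁺ to All-map⁺)
open import Data.List.Relation.Binary.Permutation.Propositional
  using (_↭_; prep; ↭-swap; ↭-sym; ↭-reflexive; ↭-refl; ↭-trans)
open import Data.List.Relation.Binary.Permutation.Propositional.Properties
  using (shift; ↭-length; All-resp-↭)
import Data.List.Relation.Binary.Permutation.Propositional.Properties as ↭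
open import Relation.Binary.Construct.Closure.ReflexiveTransitive using (Star; ε; _◅_; _◅◅_)
open import Induction.WellFounded using (Acc; acc)
open import Function using (_∘_)
open import Relation.Nullary using (¬_; Dec; yes; no; does; contradiction)
open import Relation.Nullary.Decidable using (dec-true; dec-false)
open import Relation.Binary.PropositionalEquality

-- Counting over finite index sets

iverson : Bool → ℕ
iverson true  = 1
iverson false = 0

count : ∀ {n} → (Fin n → Bool) → ℕ
count P = sum (iverson ∘ P)

_⊆_ : ∀ {n} → (Fin n → Bool) → (Fin n → Bool) → Set
P ⊆ Q = ∀ i → P i ≡ true → Q i ≡ true

∧-intro : ∀ {a b} → a ≡ true → b ≡ true → a ∧ b ≡ true
∧-intro refl refl = refl

∧-elim : ∀ {a b} → a ∧ b ≡ true → a ≡ true × b ≡ true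
∧-elim {true} {true} _ = refl , refl

∨-introʳ : ∀ a {b} → b ≡ true → a ∨ b ≡ true
∨-introʳ true  _  = refl
∨-introʳ false eq = eq

∨-elim : ∀ {a b} → a ∨ b ≡ true → a ≡ true ⊎ b ≡ true
∨-elim {true}  _  = inj₁ refl
∨-elim {false} eq = inj₂ eq

not-true⇒false : ∀ {a} → not a ≡ true → a ≡ false
not-true⇒false {false} _ = refl

_==_ : ∀ {n} → Fin n → Fin n → Bool
x == y = does (x ≟ y)

==-refl : ∀ {n} (x : Fin n) → (x == x) ≡ true
==-refl x = dec-true (x ≟ x) refl

==-≢ : ∀ {n} {x y : Fin n} → x ≢ y → (x == y) ≡ false
==-≢ {x = x} {y} = dec-false (x ≟ y)

==-sound : ∀ {n} {x y : Fin n} → (x == y) ≡ true → x ≡ y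
==-sound {x = x} {y} eq with x ≟ y
... | yes x≡y = x≡y

not-==⇒≢ : ∀ {n} {x y : Fin n} → not (x == y) ≡ true → x ≢ y
not-==⇒≢ {x = x} h refl with () ← trans (cong not (sym (==-refl x))) h

sum-zero : ∀ n → sum {n} (λ _ → 0) ≡ 0
sum-zero zero    = refl
sum-zero (suc n) = sum-zero n

sum-mono-≤ : ∀ {n} {f g : Fin n → ℕ} → (∀ i → f i ≤ g i) → sum f ≤ sum g
sum-mono-≤ {zero}  f≤g = z≤n
sum-mono-≤ {suc n} f≤g = +-mono-≤ (f≤g zero) (sum-mono-≤ (f≤g ∘ suc))

sum-sift : ∀ {n} (f : Fin n → ℕ) a → sum (λ z → f z * iverson (a == z)) ≡ f a
sum-sift {suc n} f zero = begin
  f zero * 1 + sum (λ z → f (suc z) * 0)  ≡⟨ cong₂ _+_ (*-identityʳ (f zero)) (sum-cong-≗ (*-zeroʳ ∘ f ∘ suc)) ⟩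
  f zero + sum {n} (λ _ → 0)              ≡⟨ cong (f zero +_) (sum-zero n) ⟩
  f zero + 0                              ≡⟨ +-identityʳ (f zero) ⟩
  f zero                                  ∎
  where open ≡-Reasoning
sum-sift {suc n} f (suc a) = trans (cong (_+ sum (λ z → f (suc z) * iverson (a == z))) (*-zeroʳ (f zero))) (sum-sift (f ∘ suc) a)

count-≤ : ∀ {n} (P : Fin n → Bool) → count P ≤ n
count-≤ {zero}  P = z≤n
count-≤ {suc n} P with P zero
... | true  = s≤s (count-≤ (P ∘ suc))
... | false = m≤n⇒m≤1+n (count-≤ (P ∘ suc))

count-true : ∀ n → count {n} (λ _ → true) ≡ n
count-true zero    = refl
count-true (suc n) = cong suc (count-true n)

iverson-mono : ∀ {a b} → (a ≡ true → b ≡ true) → iverson a ≤ iverson b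
iverson-mono {false}         a⇒b = z≤n
iverson-mono {true} {true}   a⇒b = ≤-refl
iverson-mono {true} {false}  a⇒b with () ← a⇒b refl

count-mono : ∀ {n} {P Q : Fin n → Bool} → P ⊆ Q → count P ≤ count Q
count-mono P⊆Q = sum-mono-≤ (λ i → iverson-mono (P⊆Q i))

count-< : ∀ {n} {P Q : Fin n → Bool} → P ⊆ Q →
          ∀ a → P a ≡ false → Q a ≡ true → count P < count Q
count-< {suc n} {P} {Q} P⊆Q zero Pa Qa rewrite Pa | Qa = s≤s (count-mono (P⊆Q ∘ suc))
count-< {suc n} {P} {Q} P⊆Q (suc a) Pa Qa =
  subst (_≤ count Q) (+-suc (iverson (P zero)) _)
    (+-mono-≤ (iverson-mono (P⊆Q zero)) (count-< (P⊆Q ∘ suc) a Pa Qa))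

count-witness : ∀ {n m} (P : Fin n → Bool) → count P ≡ suc m → ∃[ i ] P i ≡ true
count-witness {suc n} P eq with P zero in Pz
... | true  = zero , Pz
... | false with i , Pi ← count-witness (P ∘ suc) eq = suc i , Pi

count-update : ∀ {n} (P Q : Fin n → Bool) a → (∀ i → i ≢ a → P i ≡ Q i) →
               count P + iverson (Q a) ≡ count Q + iverson (P a)
count-update {suc n} P Q zero P≗Q
  rewrite sum-cong-≗ {x = iverson ∘ P ∘ suc} (λ i → cong iverson (P≗Q (suc i) λ ()))
  = swap-ends (iverson (P zero)) (iverson (Q zero)) _
  where
  swap-ends : ∀ a b c → a + c + b ≡ b + c + a
  swap-ends = solve-∀
count-update {suc n} P Q (suc a) P≗Q rewrite P≗Q zero (λ ()) =
  trans (+-assoc (iverson (Q zero)) _ _)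
    (trans (cong (iverson (Q zero) +_)
      (count-update (P ∘ suc) (Q ∘ suc) a (λ i i≢a → P≗Q (suc i) (i≢a ∘ Fin.suc-injective))))
      (sym (+-assoc (iverson (Q zero)) _ _)))

any : ∀ {n} → (Fin n → Bool) → Bool
any {zero}  P = false
any {suc n} P = P zero ∨ any (P ∘ suc)

any-sound : ∀ {n} (P : Fin n → Bool) → any P ≡ true → ∃[ i ] P i ≡ true
any-sound {suc n} P eq with P zero in Pz
... | true  = zero , Pz
... | false with i , Pi ← any-sound (P ∘ suc) eq = suc i , Pi

any-complete : ∀ {n} (P : Fin n → Bool) i → P i ≡ true → any P ≡ true
any-complete P zero    Pi rewrite Pi = refl
any-complete P (suc i) Pi with P zero
... | true  = refl
... | false = any-complete (P ∘ suc) i Pi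

_-_ : ∀ {n} → (Fin n → Bool) → Fin n → (Fin n → Bool)
(P - v) y = P y ∧ not (y == v)

count-remove : ∀ {n} (P : Fin n → Bool) v → P v ≡ true → count P ≡ suc (count (P - v))
count-remove P v Pv = begin
  count P                                  ≡⟨ +-identityʳ (count P) ⟨
  count P + 0                              ≡⟨ cong (λ b → count P + iverson b) (v∉P-v) ⟨
  count P + iverson ((P - v) v)            ≡⟨ count-update P (P - v) v agree ⟩
  count (P - v) + iverson (P v)            ≡⟨ cong (λ b → count (P - v) + iverson b) Pv ⟩
  count (P - v) + 1                        ≡⟨ +-comm (count (P - v)) 1 ⟩
  suc (count (P - v))                      ∎
  where
  open ≡-Reasoning
  agree : ∀ i → i ≢ v → P i ≡ (P - v) i
  agree i i≢v rewrite ==-≢ i≢v = sym (∧-identityʳ (P i))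
  v∉P-v : (P - v) v ≡ false
  v∉P-v rewrite ==-refl v = ∧-zeroʳ (P v)

singleton-or-other : ∀ {n} (P : Fin n → Bool) p →
  (∀ q → P q ≡ true → q ≡ p) ⊎ (Σ (Fin n) λ q → P q ≡ true × q ≢ p)
singleton-or-other P p with any (P - p) in eq
... | false = inj₁ only-p
  where
  only-p : ∀ q → P q ≡ true → q ≡ p
  only-p q Pq with q ≟ p
  ... | yes q≡p = q≡p
  ... | no  q≢p with () ← trans (sym (any-complete (P - p) q (∧-intro Pq (cong not (==-≢ q≢p))))) eq
... | true with q , Pq-q ← any-sound (P - p) eq | ∧-elim Pq-q
...   | Pq , q≢p = inj₂ (q , Pq , not-==⇒≢ q≢p)

module _ {n} (R : ℕ → (Fin n → Bool)) (R-⊆ : ∀ i → R i ⊆ R (suc i)) where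

  Stabilised : Set
  Stabilised = Σ ℕ λ K → ∀ z → R (suc K) z ≡ R K z

  chain-grows : ∀ i → Stabilised ⊎ (i ≤ count (R i))
  chain-grows zero = inj₂ z≤n
  chain-grows (suc i) with chain-grows i
  ... | inj₁ stable = inj₁ stable
  ... | inj₂ i≤∣Rᵢ∣ with any (λ z → R (suc i) z ∧ not (R i z)) in new
  ...   | true with z , z-new ← any-sound (λ z → R (suc i) z ∧ not (R i z)) new
                 with z∈ , z∉ ← ∧-elim {R (suc i) z} z-new =
    inj₂ (≤-trans (s≤s i≤∣Rᵢ∣) (count-< (R-⊆ i) z (not-true⇒false z∉) z∈))
  ...   | false = inj₁ (i , same)
    where
    same : ∀ z → R (suc i) z ≡ R i z
    same z with R i z in Rᵢz | R (suc i) z in Rᵢ₊₁z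
    ... | true  | true  = refl
    ... | false | false = refl
    ... | true  | false with () ← trans (sym (R-⊆ i z Rᵢz)) Rᵢ₊₁z
    ... | false | true  with () ← trans (sym (any-complete (λ z → R (suc i) z ∧ not (R i z)) z
                                           (subst₂ (λ x y → x ∧ not y ≡ true) (sym Rᵢ₊₁z) (sym Rᵢz) refl))) new

  chain-stabilises : Stabilised
  chain-stabilises with chain-grows (suc n)
  ... | inj₁ stable    = stable
  ... | inj₂ n<∣Rₙ₊₁∣ = contradiction (≤-trans n<∣Rₙ₊₁∣ (count-≤ (R (suc n)))) 1+n≰n

-- Edge boundaries of vertex sets

VSet : ℕ → Set
VSet n = Fin n → Bool

_∩_ _∪_ : ∀ {n} → VSet n → VSet n → VSet n
(X ∩ Y) v = X v ∧ Y v
(X ∪ Y) v = X v ∨ Y v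

∁ : ∀ {n} → VSet n → VSet n
∁ X v = not (X v)

crossing-submodular : ∀ x₁ x₂ z₁ z₂ →
  iverson ((x₁ ∧ z₁) xor (x₂ ∧ z₂)) + iverson ((x₁ ∨ z₁) xor (x₂ ∨ z₂))
    ≤ iverson (x₁ xor x₂) + iverson (z₁ xor z₂)
crossing-submodular true  true  z₁    z₂    = ≤-reflexive (+-identityʳ _)
crossing-submodular false false z₁    z₂    = ≤-refl
crossing-submodular true  false true  true  = ≤ᵇ⇒≤ _ _ tt
crossing-submodular true  false true  false = ≤ᵇ⇒≤ _ _ tt
crossing-submodular true  false false true  = ≤ᵇ⇒≤ _ _ tt
crossing-submodular true  false false false = ≤ᵇ⇒≤ _ _ tt
crossing-submodular false true  true  true  = ≤ᵇ⇒≤ _ _ tt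
crossing-submodular false true  true  false = ≤ᵇ⇒≤ _ _ tt
crossing-submodular false true  false true  = ≤ᵇ⇒≤ _ _ tt
crossing-submodular false true  false false = ≤ᵇ⇒≤ _ _ tt

not-xor-not : ∀ a b → (not a xor not b) ≡ (a xor b)
not-xor-not true  b = refl
not-xor-not false b = not-involutive b

xor-false⇒≡ : ∀ a b → (a xor b) ≡ false → a ≡ b
xor-false⇒≡ true  true  _ = refl
xor-false⇒≡ false false _ = refl

module Cuts (G : Graph) where

  Vertex : Set
  Vertex = Fin (n G)

  EdgeIx : Set
  EdgeIx = Fin (length (edges G))

  end₁ end₂ : EdgeIx → Vertex
  end₁ e = proj₁ (lookup (edges G) e)
  end₂ e = proj₂ (lookup (edges G) e)

  crosses : VSet (n G) → EdgeIx → Bool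
  crosses X e = X (end₁ e) xor X (end₂ e)

  ∂ : VSet (n G) → ℕ
  ∂ X = count (crosses X)

  ∂-submodular : ∀ X Z → ∂ (X ∩ Z) + ∂ (X ∪ Z) ≤ ∂ X + ∂ Z
  ∂-submodular X Z = begin
    ∂ (X ∩ Z) + ∂ (X ∪ Z)
      ≡⟨ ∑-distrib-+ (iverson ∘ crosses (X ∩ Z)) (iverson ∘ crosses (X ∪ Z)) ⟨
    sum (λ e → iverson (crosses (X ∩ Z) e) + iverson (crosses (X ∪ Z) e))
      ≤⟨ sum-mono-≤ (λ e → crossing-submodular (X (end₁ e)) (X (end₂ e)) (Z (end₁ e)) (Z (end₂ e))) ⟩
    sum (λ e → iverson (crosses X e) + iverson (crosses Z e))
      ≡⟨ ∑-distrib-+ (iverson ∘ crosses X) (iverson ∘ crosses Z) ⟩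
    ∂ X + ∂ Z ∎
    where open ≤-Reasoning

  ∂-∁ : ∀ X → ∂ (∁ X) ≡ ∂ X
  ∂-∁ X = sum-cong-≗ (λ e → cong iverson (not-xor-not (X (end₁ e)) (X (end₂ e))))

  MinCut : Vertex → Vertex → VSet (n G) → Set
  MinCut x y Z = Z x ≡ true × Z y ≡ false ×
                 (∀ V → V x ≡ true → V y ≡ false → ∂ Z ≤ ∂ V)

  MinCut-∁ : ∀ {x y Z} → MinCut x y Z → MinCut y x (∁ Z)
  MinCut-∁ {Z = Z} (Zx , Zy , min) =
    cong not Zy , cong not Zx ,
    λ V Vy Vx → subst₂ _≤_ (sym (∂-∁ Z)) (∂-∁ V) (min (∁ V) (cong not Vx) (cong not Vy))

  ∣tabulate∣≡count : ∀ {m} (P : Fin m → Bool) → ∣ tabulate P ∣ ≡ count P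
  ∣tabulate∣≡count {zero}  P = refl
  ∣tabulate∣≡count {suc m} P with P zero
  ... | true  = cong suc (∣tabulate∣≡count (P ∘ suc))
  ... | false = ∣tabulate∣≡count (P ∘ suc)

  uncut⇒same-side : ∀ Z e → e ∉ tabulate (crosses Z) → Z (end₁ e) ≡ Z (end₂ e)
  uncut⇒same-side Z e e∉ with crosses Z e in eq
  ... | false = xor-false⇒≡ _ _ eq
  ... | true  = contradiction (lookup⇒[]= e (tabulate (crosses Z)) (trans (lookup∘tabulate (crosses Z) e) eq)) e∉

  Conn-avoiding-cut-stays : ∀ Z {x y} → Conn G (tabulate (crosses Z)) x y → Z x ≡ Z y
  Conn-avoiding-cut-stays Z here = refl
  Conn-avoiding-cut-stays Z (fwd e e∉ refl walk) =
    trans (uncut⇒same-side Z e e∉) (Conn-avoiding-cut-stays Z walk)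
  Conn-avoiding-cut-stays Z (bwd e e∉ refl walk) =
    trans (sym (uncut⇒same-side Z e e∉)) (Conn-avoiding-cut-stays Z walk)

  cut⇒SuppAtMost : ∀ Z v (S : Vertex → Set) c → Z v ≡ true → (∀ y → S y → Z y ≡ false) →
                   ∂ Z ≤ c → SuppAtMost G v S c
  cut⇒SuppAtMost Z v S c Zv S⊆∁Z ∂Z≤c =
    tabulate (crosses Z) , subst (_≤ c) (sym (∣tabulate∣≡count (crosses Z))) ∂Z≤c ,
    λ y Sy walk → contradiction (trans (sym Zv) (trans (Conn-avoiding-cut-stays Z walk) (S⊆∁Z y Sy))) λ ()

  ∂-∩-≤ : ∀ {x y Z} W → MinCut x y Z → W y ≡ false → ∂ (W ∩ Z) ≤ ∂ W
  ∂-∩-≤ {x} {y} {Z} W (Zx , Zy , Z-min) Wy = +-cancelʳ-≤ (∂ Z) (∂ (W ∩ Z)) (∂ W) (begin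
    ∂ (W ∩ Z) + ∂ Z        ≤⟨ +-monoʳ-≤ (∂ (W ∩ Z)) (Z-min (W ∪ Z) W∪Z-x W∪Z-y) ⟩
    ∂ (W ∩ Z) + ∂ (W ∪ Z)  ≤⟨ ∂-submodular W Z ⟩
    ∂ W + ∂ Z              ∎)
    where
    open ≤-Reasoning
    W∪Z-x : W x ∨ Z x ≡ true
    W∪Z-x rewrite Zx = ∨-zeroʳ (W x)
    W∪Z-y : W y ∨ Z y ≡ false
    W∪Z-y rewrite Wy = Zy

  MinCut-uncross : ∀ {x y Z p q W} → MinCut x y Z → MinCut p q W → Z p ≡ true → W y ≡ false →
                   MinCut p q (W ∩ Z)
  MinCut-uncross {W = W} Zmin (Wp , Wq , W-min) Zp Wy =
    ∧-intro Wp Zp , cong (_∧ _) Wq , λ V Vp Vq → ≤-trans (∂-∩-≤ W Zmin Wy) (W-min V Vp Vq)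

-- Unit flows, weak duality and augmenting paths

-- The flow on an edge (p , q): none, from p to q, or from q to p.
data Dir : Set where
  off fw bw : Dir

-- Whether the tail (head) of an edge (p , q) with flow dr lies in V, given x = V p and y = V q.
tailIn headIn : Dir → Bool → Bool → Bool
tailIn off x y = false
tailIn fw  x y = x
tailIn bw  x y = y
headIn off x y = false
headIn fw  x y = y
headIn bw  x y = x

tail≤head+crossing : ∀ dr x y → iverson (tailIn dr x y) ≤ iverson (headIn dr x y) + iverson (x xor y)
tail≤head+crossing off x     y     = z≤n
tail≤head+crossing fw  true  true  = s≤s z≤n
tail≤head+crossing fw  true  false = s≤s z≤n
tail≤head+crossing fw  false y     = z≤n
tail≤head+crossing bw  true  true  = s≤s z≤n
tail≤head+crossing bw  false true  = s≤s z≤n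
tail≤head+crossing bw  x     false = z≤n

x+0+y≡y+x : ∀ x y → x + 0 + y ≡ y + x
x+0+y≡y+x x y = trans (cong (_+ y) (+-identityʳ x)) (+-comm x y)

x+y≡y+0+x : ∀ x y → x + y ≡ y + 0 + x
x+y≡y+0+x x y = trans (+-comm x y) (cong (_+ x) (sym (+-identityʳ y)))

module _ {n : ℕ} where

  isTail isHead : Dir → (p q z : Fin n) → Bool
  isTail off p q z = false
  isTail fw  p q z = p == z
  isTail bw  p q z = q == z
  isHead off p q z = false
  isHead fw  p q z = q == z
  isHead bw  p q z = p == z

  -- The edge (p , q) carrying flow dr can be traversed from a to b in the residual graph.
  data Residual : Dir → (p q a b : Fin n) → Set where
    use-fw  : ∀ {a b} → Residual off a b a b
    use-bw  : ∀ {a b} → Residual off b a a b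
    undo-bw : ∀ {a b} → Residual bw  a b a b
    undo-fw : ∀ {a b} → Residual fw  b a a b

  augment : ∀ {dr p q a b} → Residual dr p q a b → Dir
  augment use-fw  = fw
  augment use-bw  = bw
  augment undo-bw = off
  augment undo-fw = off

  residualᵇ : Dir → (p q a b : Fin n) → Bool
  residualᵇ off p q a b = (p == a ∧ q == b) ∨ (q == a ∧ p == b)
  residualᵇ fw  p q a b = q == a ∧ p == b
  residualᵇ bw  p q a b = p == a ∧ q == b

  residual-complete : ∀ {dr p q a b} → Residual dr p q a b → residualᵇ dr p q a b ≡ true
  residual-complete {a = a} {b} use-fw  rewrite ==-refl a | ==-refl b = refl
  residual-complete {a = a} {b} use-bw  rewrite ==-refl a | ==-refl b = ∨-zeroʳ _
  residual-complete {a = a} {b} undo-bw rewrite ==-refl a | ==-refl b = refl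
  residual-complete {a = a} {b} undo-fw rewrite ==-refl a | ==-refl b = refl

  residual-sound : ∀ dr p q a b → residualᵇ dr p q a b ≡ true → Residual dr p q a b
  residual-sound off p q a b r with ∨-elim {p == a ∧ q == b} r
  ... | inj₁ r₁ with p=a , q=b ← ∧-elim {p == a} r₁
                 with refl ← ==-sound {x = p} p=a | refl ← ==-sound {x = q} q=b = use-fw
  ... | inj₂ r₂ with q=a , p=b ← ∧-elim {q == a} r₂
                 with refl ← ==-sound {x = q} q=a | refl ← ==-sound {x = p} p=b = use-bw
  residual-sound fw p q a b r with q=a , p=b ← ∧-elim {q == a} r
                              with refl ← ==-sound {x = q} q=a | refl ← ==-sound {x = p} p=b = undo-fw
  residual-sound bw p q a b r with p=a , q=b ← ∧-elim {p == a} r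
                              with refl ← ==-sound {x = p} p=a | refl ← ==-sound {x = q} q=b = undo-bw

  Residual-ends : ∀ (P : Fin n → Set) {dr p q a b} → Residual dr p q a b → P a → P b → P p × P q
  Residual-ends P use-fw  Pa Pb = Pa , Pb
  Residual-ends P use-bw  Pa Pb = Pb , Pa
  Residual-ends P undo-bw Pa Pb = Pa , Pb
  Residual-ends P undo-fw Pa Pb = Pb , Pa

  Residual-target : ∀ (P : Fin n → Set) {dr p q a b} → Residual dr p q a b → P p → P q → P b
  Residual-target P use-fw  Pp Pq = Pq
  Residual-target P use-bw  Pp Pq = Pp
  Residual-target P undo-bw Pp Pq = Pq
  Residual-target P undo-fw Pp Pq = Pp

  -- Augmenting along a → b moves one unit of excess from b to a.
  augment-balance : ∀ {dr p q a b} (r : Residual dr p q a b) z →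
    iverson (isTail (augment r) p q z) + iverson (isHead dr p q z) + iverson (b == z)
      ≡ iverson (isTail dr p q z) + iverson (isHead (augment r) p q z) + iverson (a == z)
  augment-balance {a = a} {b} use-fw  z = x+0+y≡y+x (iverson (a == z)) (iverson (b == z))
  augment-balance {a = a} {b} use-bw  z = x+0+y≡y+x (iverson (a == z)) (iverson (b == z))
  augment-balance {a = a} {b} undo-bw z = x+y≡y+0+x (iverson (a == z)) (iverson (b == z))
  augment-balance {a = a} {b} undo-fw z = x+y≡y+0+x (iverson (a == z)) (iverson (b == z))

  sift-tail : ∀ dr p q (V : Fin n → Bool) →
    sum (λ z → iverson (V z) * iverson (isTail dr p q z)) ≡ iverson (tailIn dr (V p) (V q))
  sift-tail off p q V = trans (sum-cong-≗ (*-zeroʳ ∘ iverson ∘ V)) (sum-zero n)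
  sift-tail fw  p q V = sum-sift (iverson ∘ V) p
  sift-tail bw  p q V = sum-sift (iverson ∘ V) q

  sift-head : ∀ dr p q (V : Fin n → Bool) →
    sum (λ z → iverson (V z) * iverson (isHead dr p q z)) ≡ iverson (headIn dr (V p) (V q))
  sift-head off p q V = trans (sum-cong-≗ (*-zeroʳ ∘ iverson ∘ V)) (sum-zero n)
  sift-head fw  p q V = sum-sift (iverson ∘ V) q
  sift-head bw  p q V = sum-sift (iverson ∘ V) p

  -- An edge leaving a residually closed set Y must carry flow out of Y.
  crossing+head≤tail : ∀ dr p q (Y : Fin n → Bool) →
    (∀ a b → Y a ≡ true → residualᵇ dr p q a b ≡ true → Y b ≡ true) →
    iverson (Y p xor Y q) + iverson (headIn dr (Y p) (Y q)) ≤ iverson (tailIn dr (Y p) (Y q))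
  crossing+head≤tail off p q Y closed with Y p in Yp | Y q in Yq
  ... | true  | true  = z≤n
  ... | false | false = z≤n
  ... | true  | false with () ← trans (sym (closed p q Yp (residual-complete (use-fw {a = p} {q})))) Yq
  ... | false | true  with () ← trans (sym (closed q p Yq (residual-complete (use-bw {a = q} {p})))) Yp
  crossing+head≤tail fw p q Y closed with Y p in Yp | Y q in Yq
  ... | true  | true  = ≤-refl
  ... | true  | false = ≤-refl
  ... | false | false = z≤n
  ... | false | true  with () ← trans (sym (closed q p Yq (residual-complete (undo-fw {a = q} {p})))) Yp
  crossing+head≤tail bw p q Y closed with Y p in Yp | Y q in Yq
  ... | true  | true  = ≤-refl
  ... | false | true  = ≤-refl
  ... | false | false = z≤n
  ... | true  | false with () ← trans (sym (closed p q Yp (residual-complete (undo-bw {a = p} {q})))) Yq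

degree-balance : ∀ O O′ I I′ x x′ y y′ A C →
  O′ + x ≡ O + x′ → I′ + y ≡ I + y′ → x′ + y + C ≡ x + y′ + A → O′ + I + C ≡ O + I′ + A
degree-balance O O′ I I′ x x′ y y′ A C out-eq in-eq edge-eq =
  +-cancelʳ-≡ (x + x′ + y) _ _ (begin
    O′ + I + C + (x + x′ + y)          ≡⟨ shuffle₁ O′ I C x x′ y ⟩
    (O′ + x) + (x′ + y + C) + I        ≡⟨ cong₂ (λ u v → u + v + I) out-eq edge-eq ⟩
    (O + x′) + (x + y′ + A) + I        ≡⟨ shuffle₂ O x′ x y′ A I ⟩
    O + A + x + x′ + (I + y′)          ≡⟨ cong (O + A + x + x′ +_) in-eq ⟨
    O + A + x + x′ + (I′ + y)          ≡⟨ shuffle₃ O A x x′ I′ y ⟩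
    O + I′ + A + (x + x′ + y)          ∎)
  where
  open ≡-Reasoning
  shuffle₁ : ∀ O′ I C x x′ y → O′ + I + C + (x + x′ + y) ≡ (O′ + x) + (x′ + y + C) + I
  shuffle₁ = solve-∀
  shuffle₂ : ∀ O x′ x y′ A I → (O + x′) + (x + y′ + A) + I ≡ O + A + x + x′ + (I + y′)
  shuffle₂ = solve-∀
  shuffle₃ : ∀ O A x x′ I′ y → O + A + x + x′ + (I′ + y) ≡ O + I′ + A + (x + x′ + y)
  shuffle₃ = solve-∀

excess-transfer : ∀ O O′ I I′ A C T S →
  O′ + I + C ≡ O + I′ + A → O + T ≡ I + S + C → O′ + T ≡ I′ + S + A
excess-transfer O O′ I I′ A C T S balance excess =
  +-cancelʳ-≡ (O + I + C) _ _ (begin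
    O′ + T + (O + I + C)          ≡⟨ shuffle₁ O′ T O I C ⟩
    (O′ + I + C) + (O + T)        ≡⟨ cong₂ _+_ balance excess ⟩
    (O + I′ + A) + (I + S + C)    ≡⟨ shuffle₂ O I′ A I S C ⟩
    I′ + S + A + (O + I + C)      ∎)
  where
  open ≡-Reasoning
  shuffle₁ : ∀ O′ T O I C → O′ + T + (O + I + C) ≡ (O′ + I + C) + (O + T)
  shuffle₁ = solve-∀
  shuffle₂ : ∀ O I′ A I S C → (O + I′ + A) + (I + S + C) ≡ I′ + S + A + (O + I + C)
  shuffle₂ = solve-∀

module FlowNetwork (G : Graph) (s t : Fin (n G)) where
  open Cuts G

  Flow : Set
  Flow = EdgeIx → Dir

  outflow inflow : Flow → Vertex → ℕ
  outflow g z = count (λ e → isTail (g e) (end₁ e) (end₂ e) z)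
  inflow  g z = count (λ e → isHead (g e) (end₁ e) (end₂ e) z)

  IsFlow : Flow → ℕ → Set
  IsFlow g j = ∀ z → outflow g z + j * iverson (t == z) ≡ inflow g z + j * iverson (s == z)

  tails heads : Flow → VSet (n G) → ℕ
  tails g V = count (λ (e : EdgeIx) → tailIn (g e) (V (end₁ e)) (V (end₂ e)))
  heads g V = count (λ (e : EdgeIx) → headIn (g e) (V (end₁ e)) (V (end₂ e)))

  double-count : ∀ (isEnd : Dir → (p q z : Vertex) → Bool) (endIn : Dir → Bool → Bool → Bool) →
    (∀ dr (p q : Vertex) (V : VSet (n G)) →
      sum (λ z → iverson (V z) * iverson (isEnd dr p q z)) ≡ iverson (endIn dr (V p) (V q))) →
    ∀ (g : Flow) (V : VSet (n G)) → sum (λ z → iverson (V z) * count (λ e → isEnd (g e) (end₁ e) (end₂ e) z))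
              ≡ count (λ (e : EdgeIx) → endIn (g e) (V (end₁ e)) (V (end₂ e)))
  double-count isEnd endIn sift g V = begin
    sum (λ z → iverson (V z) * count (λ e → isEnd (g e) (end₁ e) (end₂ e) z))
      ≡⟨ sum-cong-≗ (λ z → *-distribˡ-sum (iverson (V z)) (λ e → iverson (isEnd (g e) (end₁ e) (end₂ e) z))) ⟩
    sum (λ z → sum (λ e → iverson (V z) * iverson (isEnd (g e) (end₁ e) (end₂ e) z)))
      ≡⟨ ∑-comm (λ z e → iverson (V z) * iverson (isEnd (g e) (end₁ e) (end₂ e) z)) ⟩
    sum (λ e → sum (λ z → iverson (V z) * iverson (isEnd (g e) (end₁ e) (end₂ e) z)))
      ≡⟨ sum-cong-≗ (λ e → sift (g e) (end₁ e) (end₂ e) V) ⟩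
    count (λ (e : EdgeIx) → endIn (g e) (V (end₁ e)) (V (end₂ e))) ∎
    where open ≡-Reasoning

  sum-weighted-+ : ∀ (w f h : Vertex → ℕ) →
                   sum (λ z → w z * (f z + h z)) ≡ sum (λ z → w z * f z) + sum (λ z → w z * h z)
  sum-weighted-+ w f h =
    trans (sum-cong-≗ (λ z → *-distribˡ-+ (w z) (f z) (h z))) (∑-distrib-+ (λ z → w z * f z) (λ z → w z * h z))

  sum-weighted-point : ∀ (V : VSet (n G)) a j → sum (λ z → iverson (V z) * (j * iverson (a == z))) ≡ iverson (V a) * j
  sum-weighted-point V a j =
    trans (sum-cong-≗ (λ z → sym (*-assoc (iverson (V z)) j _))) (sum-sift (λ z → iverson (V z) * j) a)

  tails≡heads+value : ∀ {g j} → IsFlow g j → ∀ V → V s ≡ true → V t ≡ false → tails g V ≡ heads g V + j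
  tails≡heads+value {g} {j} flow V Vs Vt = begin
    tails g V
      ≡⟨ +-identityʳ _ ⟨
    tails g V + 0
      ≡⟨ cong (λ b → tails g V + iverson b * j) Vt ⟨
    tails g V + iverson (V t) * j
      ≡⟨ cong₂ _+_ (double-count isTail tailIn sift-tail g V) (sum-weighted-point V t j) ⟨
    Σ[V] (outflow g) + Σ[V] (λ z → j * iverson (t == z))
      ≡⟨ sum-weighted-+ (iverson ∘ V) (outflow g) (λ z → j * iverson (t == z)) ⟨
    Σ[V] (λ z → outflow g z + j * iverson (t == z))
      ≡⟨ sum-cong-≗ (λ z → cong (iverson (V z) *_) (flow z)) ⟩
    Σ[V] (λ z → inflow g z + j * iverson (s == z))
      ≡⟨ sum-weighted-+ (iverson ∘ V) (inflow g) (λ z → j * iverson (s == z)) ⟩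
    Σ[V] (inflow g) + Σ[V] (λ z → j * iverson (s == z))
      ≡⟨ cong₂ _+_ (double-count isHead headIn sift-head g V) (sum-weighted-point V s j) ⟩
    heads g V + iverson (V s) * j
      ≡⟨ cong (λ b → heads g V + iverson b * j) Vs ⟩
    heads g V + (j + 0)
      ≡⟨ cong (heads g V +_) (+-identityʳ j) ⟩
    heads g V + j ∎
    where
    open ≡-Reasoning
    Σ[V] : (Vertex → ℕ) → ℕ
    Σ[V] f = sum (λ z → iverson (V z) * f z)

  flow≤cut : ∀ {g j} → IsFlow g j → ∀ V → V s ≡ true → V t ≡ false → j ≤ ∂ V
  flow≤cut {g} {j} flow V Vs Vt = +-cancelˡ-≤ (heads g V) j (∂ V) (begin
    heads g V + j   ≡⟨ tails≡heads+value flow V Vs Vt ⟨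
    tails g V       ≤⟨ sum-mono-≤ (λ (e : EdgeIx) → tail≤head+crossing (g e) (V (end₁ e)) (V (end₂ e))) ⟩
    sum (λ e → iverson (headIn (g e) (V (end₁ e)) (V (end₂ e))) + iverson (crosses V e))
                    ≡⟨ ∑-distrib-+ (λ e → iverson (headIn (g e) (V (end₁ e)) (V (end₂ e)))) (iverson ∘ crosses V) ⟩
    heads g V + ∂ V ∎)
    where open ≤-Reasoning

  ResiduallyClosed : Flow → VSet (n G) → Set
  ResiduallyClosed g Y = ∀ e a b → Y a ≡ true → residualᵇ (g e) (end₁ e) (end₂ e) a b ≡ true → Y b ≡ true

  closed-cut≤flow : ∀ {g j} → IsFlow g j → ∀ Y → Y s ≡ true → Y t ≡ false → ResiduallyClosed g Y → ∂ Y ≤ j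
  closed-cut≤flow {g} {j} flow Y Ys Yt closed = +-cancelʳ-≤ (heads g Y) (∂ Y) j (begin
    ∂ Y + heads g Y ≡⟨ ∑-distrib-+ (iverson ∘ crosses Y) (λ e → iverson (headIn (g e) (Y (end₁ e)) (Y (end₂ e)))) ⟨
    sum (λ e → iverson (crosses Y e) + iverson (headIn (g e) (Y (end₁ e)) (Y (end₂ e))))
                    ≤⟨ sum-mono-≤ (λ (e : EdgeIx) → crossing+head≤tail (g e) (end₁ e) (end₂ e) Y (closed e)) ⟩
    tails g Y       ≡⟨ tails≡heads+value flow Y Ys Yt ⟩
    heads g Y + j   ≡⟨ +-comm (heads g Y) j ⟩
    j + heads g Y   ∎)
    where open ≤-Reasoning

  module Augmentation {g : Flow} {j : ℕ} (flow : IsFlow g j) where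

    expand : VSet (n G) → VSet (n G)
    expand R z = R z ∨ any (λ e → any (λ a → R a ∧ residualᵇ (g e) (end₁ e) (end₂ e) a z))

    -- Vertices reachable from s by residual paths of length at most i.
    layer : ℕ → VSet (n G)
    layer zero    = s ==_
    layer (suc i) = expand (layer i)

    layer-⊆ : ∀ i → layer i ⊆ layer (suc i)
    layer-⊆ i z z∈ rewrite z∈ = refl

    s∈layer : ∀ i → layer i s ≡ true
    s∈layer zero    = ==-refl s
    s∈layer (suc i) = layer-⊆ i s (s∈layer i)

    -- h sends j units from s and one unit from c into t.
    IsFlow⁺ : Flow → Vertex → Set
    IsFlow⁺ h c = ∀ z → outflow h z + suc j * iverson (t == z) ≡ inflow h z + j * iverson (s == z) + iverson (c == z)

    push : ∀ {h a c} e (r : Residual (h e) (end₁ e) (end₂ e) a c) →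
           IsFlow⁺ h c → IsFlow⁺ (updateAt h e (λ _ → augment r)) a
    push {h} {a} {c} e r excess z =
      excess-transfer O O′ I I′ (iverson (a == z)) (iverson (c == z)) _ _
        (degree-balance O O′ I I′ (tailᵉ (h e)) (tailᵉ (h′ e)) (headᵉ (h e)) (headᵉ (h′ e)) _ _ out-eq in-eq edge-eq)
        (excess z)
      where
      h′ : Flow
      h′ = updateAt h e (λ _ → augment r)
      h′≗h : ∀ e′ → e′ ≢ e → h′ e′ ≡ h e′
      h′≗h e′ e′≢e = updateAt-minimal e′ e h e′≢e
      O O′ I I′ : ℕ
      O  = outflow h z
      O′ = outflow h′ z
      I  = inflow h z
      I′ = inflow h′ z
      tailᵉ headᵉ : Dir → ℕ
      tailᵉ d = iverson (isTail d (end₁ e) (end₂ e) z)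
      headᵉ d = iverson (isHead d (end₁ e) (end₂ e) z)
      out-eq : O′ + tailᵉ (h e) ≡ O + tailᵉ (h′ e)
      out-eq = count-update (λ e′ → isTail (h′ e′) (end₁ e′) (end₂ e′) z)
                            (λ e′ → isTail (h e′) (end₁ e′) (end₂ e′) z) e
                 (λ e′ e′≢e → cong (λ d → isTail d (end₁ e′) (end₂ e′) z) (h′≗h e′ e′≢e))
      in-eq : I′ + headᵉ (h e) ≡ I + headᵉ (h′ e)
      in-eq = count-update (λ e′ → isHead (h′ e′) (end₁ e′) (end₂ e′) z)
                           (λ e′ → isHead (h e′) (end₁ e′) (end₂ e′) z) e
                (λ e′ e′≢e → cong (λ d → isHead d (end₁ e′) (end₂ e′) z) (h′≗h e′ e′≢e))
      edge-eq : tailᵉ (h′ e) + headᵉ (h e) + iverson (c == z) ≡ tailᵉ (h e) + headᵉ (h′ e) + iverson (a == z)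
      edge-eq = subst (λ d → tailᵉ d + headᵉ (h e) + iverson (c == z) ≡ tailᵉ (h e) + headᵉ d + iverson (a == z))
                  (sym (updateAt-updates e h)) (augment-balance r z)

    Agrees : ℕ → Flow → Set
    Agrees i h = ∀ e → layer i (end₁ e) ≡ true → layer i (end₂ e) ≡ true → h e ≡ g e

    -- Walk back from c to s through the layers, augmenting one edge per layer.
    augment-path : ∀ i {c} → layer i c ≡ true → ∀ {h} → IsFlow⁺ h c → Agrees i h →
                   Σ Flow λ h′ → IsFlow h′ (suc j)
    augment-path zero {c} c∈ {h} excess _ with refl ← ==-sound {x = s} c∈ =
      h , λ z → trans (excess z) (trans (+-assoc (inflow h z) _ _)
                  (cong (inflow h z +_) (+-comm (j * iverson (s == z)) (iverson (s == z)))))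
    augment-path (suc i) {c} c∈ {h} excess agree with layer i c in c∈ᵢ
    ... | true  = augment-path i c∈ᵢ excess (λ e p∈ q∈ → agree e (layer-⊆ i _ p∈) (layer-⊆ i _ q∈))
    ... | false with e , e-hit ← any-sound _ c∈
                with a , a-hit ← any-sound _ e-hit
                with a∈ , res ← ∧-elim {layer i a} a-hit =
      augment-path i a∈ (push e r excess) agree′
      where
      r₀ : Residual (g e) (end₁ e) (end₂ e) a c
      r₀ = residual-sound _ _ _ _ _ res
      he≡ge : h e ≡ g e
      he≡ge with p∈ , q∈ ← Residual-ends (λ v → layer (suc i) v ≡ true) r₀
                              (layer-⊆ i a a∈) (∨-introʳ (layer i c) c∈) = agree e p∈ q∈
      r : Residual (h e) (end₁ e) (end₂ e) a c
      r = subst (λ d → Residual d (end₁ e) (end₂ e) a c) (sym he≡ge) r₀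
      agree′ : Agrees i (updateAt h e (λ _ → augment r))
      agree′ e′ p∈ q∈ with e′ ≟ e
      ... | yes refl with () ← trans (sym (Residual-target (λ v → layer i v ≡ true) r₀ p∈ q∈)) c∈ᵢ
      ... | no e′≢e = trans (updateAt-minimal e′ e h e′≢e) (agree e′ (layer-⊆ i _ p∈) (layer-⊆ i _ q∈))

    augment-or-cut : (Σ Flow λ h → IsFlow h (suc j)) ⊎
                     (Σ (VSet (n G)) λ Y → Y s ≡ true × Y t ≡ false × ∂ Y ≤ j)
    augment-or-cut with K , stable ← chain-stabilises layer layer-⊆
                   with layer K t in t∈?
    ...   | true  = inj₁ (augment-path K t∈? initial (λ _ _ _ → refl))
      where
      initial : IsFlow⁺ g t
      initial z = begin
        outflow g z + (iverson (t == z) + j * iverson (t == z))  ≡⟨ cong (outflow g z +_) (+-comm _ (j * iverson (t == z))) ⟩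
        outflow g z + (j * iverson (t == z) + iverson (t == z))  ≡⟨ +-assoc (outflow g z) _ _ ⟨
        outflow g z + j * iverson (t == z) + iverson (t == z)    ≡⟨ cong (_+ iverson (t == z)) (flow z) ⟩
        inflow g z + j * iverson (s == z) + iverson (t == z)     ∎
        where open ≡-Reasoning
    ...   | false = inj₂ (layer K , s∈layer K , t∈? , closed-cut≤flow {g} flow (layer K) (s∈layer K) t∈? closed)
      where
      closed : ResiduallyClosed g (layer K)
      closed e a b a∈ res = trans (sym (stable b))
        (∨-introʳ (layer K b) (any-complete _ e (any-complete _ a (∧-intro a∈ res))))

  zero-flow : IsFlow (λ _ → off) 0
  zero-flow z = refl

  flow-or-mincut : ∀ r → (Σ Flow λ g → IsFlow g r) ⊎ (Σ (VSet (n G)) λ Y → MinCut s t Y × ∂ Y < r)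
  flow-or-mincut zero = inj₁ ((λ _ → off) , zero-flow)
  flow-or-mincut (suc r) with flow-or-mincut r
  ... | inj₂ (Y , Ymin , ∂Y<r) = inj₂ (Y , Ymin , m≤n⇒m≤1+n ∂Y<r)
  ... | inj₁ (g , flow) with Augmentation.augment-or-cut {g} flow
  ...   | inj₁ bigger-flow = inj₁ bigger-flow
  ...   | inj₂ (Y , Ys , Yt , ∂Y≤r) =
    inj₂ (Y , (Ys , Yt , λ V Vs Vt → ≤-trans ∂Y≤r (flow≤cut {g} flow V Vs Vt)) , s≤s ∂Y≤r)

-- From a flow of value v to an immersion of θ v

module _ {A : Set} where

  countᴸ : (A → Bool) → List A → ℕ
  countᴸ P xs = ℕᴸ.sum (map (iverson ∘ P) xs)

  countᴸ-↭ : ∀ P {xs ys} → xs ↭ ys → countᴸ P xs ≡ countᴸ P ys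
  countᴸ-↭ P xs↭ys = ℕᴸ.sum-↭ (↭.map⁺ (iverson ∘ P) xs↭ys)

  countᴸ-none : ∀ P xs → All (λ x → P x ≡ false) xs → countᴸ P xs ≡ 0
  countᴸ-none P []       []          = refl
  countᴸ-none P (x ∷ xs) (Px ∷ none) rewrite Px = countᴸ-none P xs none

  find : ∀ (P : A → Bool) xs →
         (Σ A λ x → P x ≡ true × Σ (List A) λ rest → xs ↭ x ∷ rest) ⊎ All (λ x → P x ≡ false) xs
  find P [] = inj₂ []
  find P (x ∷ xs) with P x in Px
  ... | true  = inj₁ (x , Px , xs , ↭-refl)
  ... | false with find P xs
  ...   | inj₂ none = inj₂ (Px ∷ none)
  ...   | inj₁ (y , Py , rest , xs↭) = inj₁ (y , Py , x ∷ rest , ↭-trans (prep x xs↭) (↭-swap x y ↭-refl))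

  select : ∀ (P : A → Bool) xs m → m ≤ countᴸ P xs →
           Σ (List A) λ chosen → Σ (List A) λ others →
             xs ↭ chosen ++ others × length chosen ≡ m × All (λ x → P x ≡ true) chosen
  select P xs zero _ = [] , xs , ↭-refl , refl , []
  select P (x ∷ xs) (suc m) m≤ with P x in Px
  ... | true with chosen , others , xs↭ , len , all ← select P xs m (≤-pred m≤) =
    x ∷ chosen , others , prep x xs↭ , cong suc len , Px ∷ all
  ... | false with chosen , others , xs↭ , len , all ← select P xs (suc m) m≤ =
    chosen , x ∷ others , ↭-trans (prep x xs↭) (↭-sym (shift x chosen others)) , len , all

module _ {N : ℕ} where

  Reaches : List (Edge N) → List (Edge N) → Set
  Reaches E F = Σ (List (Edge N)) λ F′ → Star Step E F′ × F′ ↭ F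

  Step-resp-↭ : ∀ {E E′ F : List (Edge N)} → E ↭ E′ → Step E′ F → Step E F
  Step-resp-↭ E↭ (delete e rest E′↭)                  = delete e rest (↭-trans E↭ E′↭)
  Step-resp-↭ E↭ (lift e₁ e₂ rest u a b E′↭ j₁ j₂ a≢b) = lift e₁ e₂ rest u a b (↭-trans E↭ E′↭) j₁ j₂ a≢b

  Reaches-step : ∀ {E F F′} → Reaches E F → Step F F′ → Reaches E F′
  Reaches-step (_ , steps , ↭F) step = _ , steps ◅◅ (Step-resp-↭ ↭F step ◅ ε) , ↭-refl

  Reaches-↭ : ∀ {E F F′} → Reaches E F → F ↭ F′ → Reaches E F′
  Reaches-↭ (_ , steps , ↭F) F↭ = _ , steps , ↭-trans ↭F F↭

  Reaches-drop : ∀ {E} F W → Reaches E (F ++ W) → Reaches E F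
  Reaches-drop F []      reach = Reaches-↭ reach (↭-reflexive (++-identityʳ F))
  Reaches-drop F (w ∷ W) reach = Reaches-drop F W (Reaches-step reach (delete w (F ++ W) (shift w F W)))

  Joins-sym : ∀ {e : Edge N} {x y} → Joins e x y → Joins e y x
  Joins-sym (inj₁ p) = inj₂ p
  Joins-sym (inj₂ p) = inj₁ p

  Joins-unique : ∀ {e : Edge N} {a b c} → Joins e a b → Joins e a c → b ≡ c
  Joins-unique (inj₁ (refl , refl)) (inj₁ (refl , refl)) = refl
  Joins-unique (inj₁ (refl , refl)) (inj₂ (refl , refl)) = refl
  Joins-unique (inj₂ (refl , refl)) (inj₁ (refl , refl)) = refl
  Joins-unique (inj₂ (refl , refl)) (inj₂ (refl , refl)) = refl

  mult-∷ : ∀ (e : Edge N) E x y → mult (e ∷ E) x y ≡ mult (e ∷ []) x y + mult E x y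
  mult-∷ e E x y with joins? e x y
  ... | yes _ = refl
  ... | no  _ = refl

  mult-↭ : ∀ {E F : List (Edge N)} x y → E ↭ F → mult E x y ≡ mult F x y
  mult-↭ x y _↭_.refl = refl
  mult-↭ x y (prep e E↭F) =
    trans (mult-∷ e _ x y) (trans (cong (_ +_) (mult-↭ x y E↭F)) (sym (mult-∷ e _ x y)))
  mult-↭ {e₁ ∷ e₂ ∷ E} {_ ∷ _ ∷ F} x y (_↭_.swap e₁ e₂ E↭F) = begin
    mult (e₁ ∷ e₂ ∷ E) x y   ≡⟨ trans (mult-∷ e₁ _ x y) (cong (m₁ +_) (mult-∷ e₂ E x y)) ⟩
    m₁ + (m₂ + mult E x y)   ≡⟨ cong (λ m → m₁ + (m₂ + m)) (mult-↭ x y E↭F) ⟩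
    m₁ + (m₂ + mult F x y)   ≡⟨ +-swap-front m₁ m₂ (mult F x y) ⟩
    m₂ + (m₁ + mult F x y)   ≡⟨ trans (mult-∷ e₂ _ x y) (cong (m₂ +_) (mult-∷ e₁ F x y)) ⟨
    mult (e₂ ∷ e₁ ∷ F) x y   ∎
    where
    open ≡-Reasoning
    m₁ = mult (e₁ ∷ []) x y
    m₂ = mult (e₂ ∷ []) x y
    +-swap-front : ∀ a b c → a + (b + c) ≡ b + (a + c)
    +-swap-front = solve-∀
  mult-↭ x y (_↭_.trans E↭F F↭H) = trans (mult-↭ x y E↭F) (mult-↭ x y F↭H)

  mult-all : ∀ (E : List (Edge N)) x y → All (λ e → Joins e x y) E → mult E x y ≡ length E
  mult-all []      x y []         = refl
  mult-all (e ∷ E) x y (j ∷ all) with joins? e x y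
  ... | yes _ = cong suc (mult-all E x y all)
  ... | no ¬j = contradiction j ¬j

  mult-none : ∀ (E : List (Edge N)) x y → All (λ e → ¬ Joins e x y) E → mult E x y ≡ 0
  mult-none []      x y []          = refl
  mult-none (e ∷ E) x y (¬j ∷ none) with joins? e x y
  ... | yes j = contradiction j ¬j
  ... | no  _ = mult-none E x y none

  mult-replicate : ∀ r (e : Edge N) x y → mult (replicate r e) x y ≡ r * mult (e ∷ []) x y
  mult-replicate zero    e x y = refl
  mult-replicate (suc r) e x y = trans (mult-∷ e _ x y) (cong (_ +_) (mult-replicate r e x y))

θ-immersion : ∀ G {s t} → s ≢ t → (E : List (Edge (n G))) →
              Reaches (edges G) E → All (λ e → Joins e s t) E → Immersion (θ (length E)) G
θ-immersion G {s} {t} s≢t E (F , steps , F↭E) joins-st =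
  F , steps , f , f-inj , mults , All-resp-↭ (↭-sym F↭E) (All.map ends joins-st)
  where
  f : Fin 2 → Fin (n G)
  f zero       = s
  f (suc zero) = t
  f-inj : ∀ i j → f i ≡ f j → i ≡ j
  f-inj zero       zero       _  = refl
  f-inj zero       (suc zero) eq = contradiction eq s≢t
  f-inj (suc zero) zero       eq = contradiction (sym eq) s≢t
  f-inj (suc zero) (suc zero) _  = refl
  ends : ∀ {e : Edge (n G)} → Joins e s t → (∃[ i ] f i ≡ proj₁ e) × (∃[ j ] f j ≡ proj₂ e)
  ends (inj₁ (refl , refl)) = (zero , refl) , (suc zero , refl)
  ends (inj₂ (refl , refl)) = (suc zero , refl) , (zero , refl)
  r = length E
  mults : ∀ x y → mult (replicate r θ-edge) x y ≡ mult F (f x) (f y)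
  mults x y = trans (mult-replicate r θ-edge x y) (trans (mults-E x y) (mult-↭ (f x) (f y) (↭-sym F↭E)))
    where
    mults-E : ∀ x y → r * mult (θ-edge ∷ []) x y ≡ mult E (f x) (f y)
    mults-E zero       zero       = trans (*-zeroʳ r)
      (sym (mult-none E s s (All.map (λ j j′ → s≢t (sym (Joins-unique j j′))) joins-st)))
    mults-E zero       (suc zero) = trans (*-identityʳ r) (sym (mult-all E s t joins-st))
    mults-E (suc zero) zero       = trans (*-identityʳ r) (sym (mult-all E t s (All.map Joins-sym joins-st)))
    mults-E (suc zero) (suc zero) = trans (*-zeroʳ r)
      (sym (mult-none E t t (All.map (λ j j′ → s≢t (Joins-unique (Joins-sym j) j′)) joins-st)))

splice-arith : ∀ A X B O I T S → A + (X + O) + T ≡ X + (B + I) + S → A + O + T ≡ B + I + S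
splice-arith A X B O I T S eq = +-cancelˡ-≡ X _ _ (trans (shuffle X A O T) (trans eq (+-assoc X (B + I) S)))
  where
  shuffle : ∀ X A O T → X + (A + O + T) ≡ A + (X + O) + T
  shuffle = solve-∀

record Arc (N : ℕ) : Set where
  constructor arc
  field
    edge      : Edge N
    tail head : Fin N
open Arc

WellFormed : ∀ {N} → Arc N → Set
WellFormed α = Joins (edge α) (tail α) (head α) × tail α ≢ head α

module PathLifting (G : Graph) {s t : Fin (n G)} (s≢t : s ≢ t) where

  outdeg indeg : List (Arc (n G)) → Fin (n G) → ℕ
  outdeg P z = countᴸ (λ α → tail α == z) P
  indeg  P z = countᴸ (λ α → head α == z) P

  Balanced : ℕ → List (Arc (n G)) → Set
  Balanced v P = ∀ z → outdeg P z + v * iverson (t == z) ≡ indeg P z + v * iverson (s == z)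

  inner : Fin (n G) → Bool
  inner z = not (s == z) ∧ not (t == z)

  inner-false : ∀ z → inner z ≡ false → s ≡ z ⊎ t ≡ z
  inner-false z _ with s ≟ z | t ≟ z
  ... | yes s≡z | _       = inj₁ s≡z
  ... | no  _   | yes t≡z = inj₂ t≡z

  Balanced-inner : ∀ {v P} → Balanced v P → ∀ y → inner y ≡ true → outdeg P y ≡ indeg P y
  Balanced-inner {v} {P} bal y y-inner with s≠y , t≠y ← ∧-elim {not (s == y)} y-inner = begin
    outdeg P y                          ≡⟨ trans (cong (outdeg P y +_) (*-zeroʳ v)) (+-identityʳ _) ⟨
    outdeg P y + v * 0                  ≡⟨ cong (λ b → outdeg P y + v * iverson b) (not-true⇒false t≠y) ⟨
    outdeg P y + v * iverson (t == y)   ≡⟨ bal y ⟩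
    indeg P y + v * iverson (s == y)    ≡⟨ cong (λ b → indeg P y + v * iverson b) (not-true⇒false s≠y) ⟩
    indeg P y + v * 0                   ≡⟨ trans (cong (indeg P y +_) (*-zeroʳ v)) (+-identityʳ _) ⟩
    indeg P y                           ∎
    where open ≡-Reasoning

  st-edge : ∀ {α} → WellFormed α → inner (tail α) ≡ false → (head α == t) ≡ true → Joins (edge α) s t
  st-edge {arc e y z} (joins , y≢z) y-outer z=t with refl ← ==-sound {x = z} z=t with inner-false y y-outer
  ... | inj₁ refl = joins
  ... | inj₂ refl = contradiction refl y≢z

  outer≢inner : ∀ {a y} → inner a ≡ false → inner y ≡ true → (a == y) ≡ false
  outer≢inner {a} {y} a-outer y-inner with inner-false a a-outer | ∧-elim {not (s == y)} y-inner
  ... | inj₁ refl | s≠y , _   = not-true⇒false s≠y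
  ... | inj₂ refl | _   , t≠y = not-true⇒false t≠y

  indeg-inner : ∀ P → All (λ α → inner (head α) ≡ false) P → ∀ y → inner y ≡ true → indeg P y ≡ 0
  indeg-inner P heads-outer y y-inner = countᴸ-none _ P (All.map (λ h → outer≢inner h y-inner) heads-outer)

  tails-outer : ∀ {v P} → Balanced v P →
                All (λ α → inner (head α) ≡ false) P → All (λ α → inner (tail α) ≡ false) P
  tails-outer {v} {P} bal heads-outer with find (inner ∘ tail) P
  ... | inj₂ all = all
  ... | inj₁ (α , y-inner , rest , P↭) = contradiction (begin
    0                                   ≡⟨ indeg-inner P heads-outer y y-inner ⟨
    indeg P y                           ≡⟨ Balanced-inner {v} {P} bal y y-inner ⟨
    outdeg P y                          ≡⟨ countᴸ-↭ (λ β → tail β == y) P↭ ⟩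
    iverson (y == y) + outdeg rest y    ≡⟨ cong (λ b → iverson b + outdeg rest y) (==-refl y) ⟩
    suc (outdeg rest y)                 ∎) 0≢1+n
    where
    open ≡-Reasoning
    y = tail α

  value≤indeg-t : ∀ {v P} → Balanced v P → v ≤ indeg P t
  value≤indeg-t {v} {P} bal = begin
    v                                 ≡⟨ *-identityʳ v ⟨
    v * 1                             ≤⟨ m≤n+m (v * 1) (outdeg P t) ⟩
    outdeg P t + v * 1                ≡⟨ cong (λ b → outdeg P t + v * iverson b) (==-refl t) ⟨
    outdeg P t + v * iverson (t == t) ≡⟨ bal t ⟩
    indeg P t + v * iverson (s == t)  ≡⟨ cong (λ b → indeg P t + v * iverson b) (==-≢ s≢t) ⟩
    indeg P t + v * 0                 ≡⟨ trans (cong (indeg P t +_) (*-zeroʳ v)) (+-identityʳ _) ⟩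
    indeg P t                         ∎
    where open ≤-Reasoning

  -- Once no arc ends at an inner vertex, every arc runs between s and t, and at least v of them end at t.
  outer-arcs-immersion : ∀ {v} P → Reaches (edges G) (map edge P) → All WellFormed P → Balanced v P →
                         All (λ α → inner (head α) ≡ false) P → Immersion (θ v) G
  outer-arcs-immersion {v} P reach wf bal heads-outer =
    immersion (select (λ α → head α == t) P v (value≤indeg-t {v} {P} bal))
    where
    immersion : (Σ (List (Arc (n G))) λ chosen → Σ (List (Arc (n G))) λ others →
                   P ↭ chosen ++ others × length chosen ≡ v × All (λ α → (head α == t) ≡ true) chosen) →
                Immersion (θ v) G
    immersion (chosen , others , P↭ , ∣chosen∣≡v , chosen→t) =
      subst (λ r → Immersion (θ r) G) (trans (length-map edge chosen) ∣chosen∣≡v)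
        (θ-immersion G s≢t (map edge chosen) reach-chosen (All-map⁺ chosen-st))
      where
      chosen-st : All (λ α → Joins (edge α) s t) chosen
      chosen-st = All.zipWith (λ ((wf , outer) , →t) → st-edge wf outer →t)
        (++⁻ˡ chosen (All-resp-↭ P↭ (All.zip (wf , tails-outer {v} bal heads-outer))) , chosen→t)
      reach-chosen : Reaches (edges G) (map edge chosen)
      reach-chosen = Reaches-drop (map edge chosen) (map edge others)
        (Reaches-↭ reach (↭-trans (↭.map⁺ edge P↭) (↭-reflexive (map-++ edge chosen others))))

  Balanced-↭ : ∀ {v P Q} → P ↭ Q → Balanced v P → Balanced v Q
  Balanced-↭ {v} {P} {Q} P↭Q bal z = begin
    outdeg Q z + v * iverson (t == z)  ≡⟨ cong (_+ v * iverson (t == z)) (countᴸ-↭ (λ α → tail α == z) P↭Q) ⟨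
    outdeg P z + v * iverson (t == z)  ≡⟨ bal z ⟩
    indeg P z + v * iverson (s == z)   ≡⟨ cong (_+ v * iverson (s == z)) (countᴸ-↭ (λ α → head α == z) P↭Q) ⟩
    indeg Q z + v * iverson (s == z)   ∎
    where open ≡-Reasoning

  splice-balance : ∀ {v e₁ e₂ a x b P₂} → Balanced v (arc e₁ a x ∷ arc e₂ x b ∷ P₂) →
                   ∀ z → iverson (a == z) + outdeg P₂ z + v * iverson (t == z)
                           ≡ iverson (b == z) + indeg P₂ z + v * iverson (s == z)
  splice-balance {v} {a = a} {x} {b} {P₂} bal z =
    splice-arith (iverson (a == z)) (iverson (x == z)) (iverson (b == z)) (outdeg P₂ z) (indeg P₂ z) _ _ (bal z)

  splice-loop-balance : ∀ {v e₁ e₂ a x P₂} → Balanced v (arc e₁ a x ∷ arc e₂ x a ∷ P₂) → Balanced v P₂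
  splice-loop-balance {v} {e₁} {e₂} {a} {x} {P₂} bal z = +-cancelˡ-≡ (iverson (a == z)) _ _ (begin
    iverson (a == z) + (outdeg P₂ z + v * iverson (t == z))  ≡⟨ +-assoc (iverson (a == z)) _ _ ⟨
    iverson (a == z) + outdeg P₂ z + v * iverson (t == z)    ≡⟨ splice-balance {v} {e₁} {e₂} {a} {x} {a} {P₂} bal z ⟩
    iverson (a == z) + indeg P₂ z + v * iverson (s == z)     ≡⟨ +-assoc (iverson (a == z)) _ _ ⟩
    iverson (a == z) + (indeg P₂ z + v * iverson (s == z))   ∎)
    where open ≡-Reasoning

  entering⇒leaving : ∀ {v P e a x P₁} → Balanced v P → All WellFormed P → P ↭ arc e a x ∷ P₁ → inner x ≡ true →
                     ¬ All (λ α → (tail α == x) ≡ false) P₁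
  entering⇒leaving {v} {P} {e} {a} {x} {P₁} bal wf P↭ x-inner none-leave = 0≢1+n (begin
    0                                   ≡⟨ cong₂ (λ b m → iverson b + m) (==-≢ a≢x) (countᴸ-none _ P₁ none-leave) ⟨
    iverson (a == x) + outdeg P₁ x      ≡⟨ countᴸ-↭ (λ α → tail α == x) P↭ ⟨
    outdeg P x                          ≡⟨ Balanced-inner {v} {P} bal x x-inner ⟩
    indeg P x                           ≡⟨ countᴸ-↭ (λ α → head α == x) P↭ ⟩
    iverson (x == x) + indeg P₁ x       ≡⟨ cong (λ b → iverson b + indeg P₁ x) (==-refl x) ⟩
    suc (indeg P₁ x)                    ∎)
    where
    open ≡-Reasoning
    a≢x : a ≢ x
    a≢x = proj₂ (All.head (All-resp-↭ P↭ wf))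

  -- Repeatedly take an arc a → x into an inner vertex x and an arc x → b leaving it, and lift them to a → b.
  lift-paths : ∀ {v} P → Acc _<_ (length P) → Reaches (edges G) (map edge P) → All WellFormed P → Balanced v P →
               Immersion (θ v) G
  lift-paths {v} P (acc smaller) reach wf bal with find (inner ∘ head) P
  ... | inj₂ heads-outer = outer-arcs-immersion {v} P reach wf bal heads-outer
  ... | inj₁ (arc e₁ a x , x-inner , P₁ , P↭) with find (λ α → tail α == x) P₁
  ...   | inj₂ none-leave = contradiction none-leave (entering⇒leaving {v} bal wf P↭ x-inner)
  ...   | inj₁ (arc e₂ x′ b , x′=x , P₂ , P₁↭) with refl ← ==-sound {x = x′} x′=x =
    splice (a ≟ b) (All-resp-↭ P↭₂ wf)
    where
    P↭₂ : P ↭ arc e₁ a x ∷ arc e₂ x b ∷ P₂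
    P↭₂ = ↭-trans P↭ (prep _ P₁↭)
    reach₂ : Reaches (edges G) (e₁ ∷ e₂ ∷ map edge P₂)
    reach₂ = Reaches-↭ reach (↭.map⁺ edge P↭₂)
    bal₂ : Balanced v (arc e₁ a x ∷ arc e₂ x b ∷ P₂)
    bal₂ = Balanced-↭ {v} P↭₂ bal
    shorter : suc (length P₂) < length P
    shorter = ≤-reflexive (sym (↭-length P↭₂))
    splice : Dec (a ≡ b) → All WellFormed (arc e₁ a x ∷ arc e₂ x b ∷ P₂) → Immersion (θ v) G
    splice (yes refl) (_ ∷ _ ∷ wf₂) =
      lift-paths {v} P₂ (smaller (<-trans (n<1+n _) shorter))
        (Reaches-step (Reaches-step reach₂ (delete e₁ _ ↭-refl)) (delete e₂ _ ↭-refl)) wf₂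
        (splice-loop-balance {v} {e₁} {e₂} {a} {x} {P₂} bal₂)
    splice (no a≢b) ((joins₁ , _) ∷ (joins₂ , _) ∷ wf₂) =
      lift-paths {v} (arc (a , b) a b ∷ P₂) (smaller shorter)
        (Reaches-step reach₂ (lift e₁ e₂ (map edge P₂) x a b ↭-refl (Joins-sym joins₁) joins₂ a≢b))
        ((inj₁ (refl , refl) , a≢b) ∷ wf₂) (splice-balance {v} {e₁} {e₂} {a} {x} {b} {P₂} bal₂)

module _ {N : ℕ} where

  orient : Dir → Edge N → List (Arc N)
  orient off e = []
  orient fw  e = arc e (proj₁ e) (proj₂ e) ∷ []
  orient bw  e = arc e (proj₂ e) (proj₁ e) ∷ []

  idle : Dir → Edge N → List (Edge N)
  idle off e = e ∷ []
  idle fw  e = []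
  idle bw  e = []

  arcs : (E : List (Edge N)) → (Fin (length E) → Dir) → List (Arc N)
  arcs []      d = []
  arcs (e ∷ E) d = orient (d zero) e ++ arcs E (d ∘ suc)

  idles : (E : List (Edge N)) → (Fin (length E) → Dir) → List (Edge N)
  idles []      d = []
  idles (e ∷ E) d = idle (d zero) e ++ idles E (d ∘ suc)

  arcs-↭ : ∀ E d → E ↭ map edge (arcs E d) ++ idles E d
  arcs-↭ []      d = ↭-refl
  arcs-↭ (e ∷ E) d with d zero
  ... | off = ↭-trans (prep e (arcs-↭ E (d ∘ suc))) (↭-sym (shift e (map edge (arcs E (d ∘ suc))) (idles E (d ∘ suc))))
  ... | fw  = prep e (arcs-↭ E (d ∘ suc))
  ... | bw  = prep e (arcs-↭ E (d ∘ suc))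

  arcs-wf : ∀ E d → All (λ e → proj₁ e ≢ proj₂ e) E → All WellFormed (arcs E d)
  arcs-wf []      d []               = []
  arcs-wf (e ∷ E) d (u≢v ∷ loopless) with d zero
  ... | off = arcs-wf E (d ∘ suc) loopless
  ... | fw  = (inj₁ (refl , refl) , u≢v) ∷ arcs-wf E (d ∘ suc) loopless
  ... | bw  = (inj₂ (refl , refl) , u≢v ∘ sym) ∷ arcs-wf E (d ∘ suc) loopless

  outdeg-arcs : ∀ E d z → countᴸ (λ α → tail α == z) (arcs E d)
                            ≡ count (λ i → isTail (d i) (proj₁ (lookup E i)) (proj₂ (lookup E i)) z)
  outdeg-arcs []      d z = refl
  outdeg-arcs (e ∷ E) d z with d zero
  ... | off = outdeg-arcs E (d ∘ suc) z
  ... | fw  = cong (iverson (proj₁ e == z) +_) (outdeg-arcs E (d ∘ suc) z)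
  ... | bw  = cong (iverson (proj₂ e == z) +_) (outdeg-arcs E (d ∘ suc) z)

  indeg-arcs : ∀ E d z → countᴸ (λ α → head α == z) (arcs E d)
                           ≡ count (λ i → isHead (d i) (proj₁ (lookup E i)) (proj₂ (lookup E i)) z)
  indeg-arcs []      d z = refl
  indeg-arcs (e ∷ E) d z with d zero
  ... | off = indeg-arcs E (d ∘ suc) z
  ... | fw  = cong (iverson (proj₂ e == z) +_) (indeg-arcs E (d ∘ suc) z)
  ... | bw  = cong (iverson (proj₁ e == z) +_) (indeg-arcs E (d ∘ suc) z)

flow⇒θ-immersion : ∀ G {s t} → s ≢ t → ∀ {g v} → FlowNetwork.IsFlow G s t g v → Immersion (θ v) G
flow⇒θ-immersion G {s} {t} s≢t {g} {v} flow =
  lift-paths {v} (arcs (edges G) g) (<-wellFounded _) reach (arcs-wf (edges G) g (loopless G)) balanced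
  where
  open PathLifting G s≢t
  reach : Reaches (edges G) (map edge (arcs (edges G) g))
  reach = Reaches-drop _ (idles (edges G) g) (edges G , ε , arcs-↭ (edges G) g)
  balanced : Balanced v (arcs (edges G) g)
  balanced z = begin
    outdeg (arcs (edges G) g) z + v * iverson (t == z)  ≡⟨ cong (_+ _) (outdeg-arcs (edges G) g z) ⟩
    FlowNetwork.outflow G s t g z + v * iverson (t == z) ≡⟨ flow z ⟩
    FlowNetwork.inflow G s t g z + v * iverson (s == z)  ≡⟨ cong (_+ _) (indeg-arcs (edges G) g z) ⟨
    indeg (arcs (edges G) g) z + v * iverson (s == z)   ∎
    where open ≡-Reasoning

no-θ⇒small-mincut : ∀ G k → ¬ Immersion (θ (suc k)) G →
  ∀ x y → x ≢ y → Σ (VSet (n G)) λ Z → Cuts.MinCut G x y Z × Cuts.∂ G Z ≤ k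
no-θ⇒small-mincut G k no-θ x y x≢y with FlowNetwork.flow-or-mincut G x y (suc k)
... | inj₁ (g , flow)           = contradiction (flow⇒θ-immersion G x≢y {g} flow) no-θ
... | inj₂ (Z , Zmin , ∂Z<1+k) = Z , Zmin , ≤-pred ∂Z<1+k

-- Isolating cuts and the layout

Injective : ∀ {A B : Set} → (A → B) → Set
Injective f = ∀ i j → f i ≡ f j → i ≡ j

injective⇒surjective : ∀ {n} (f : Fin n → Fin n) → Injective f → ∀ y → ∃[ i ] f i ≡ y
injective⇒surjective {zero}  f f-inj ()
injective⇒surjective {suc n} f f-inj y with Fin.any? (λ i → f i Fin.≟ y)
... | yes hit = hit
... | no  miss = contradiction (Fin.injective⇒≤ g-inj) 1+n≰n
  where
  g : Fin (suc n) → Fin n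
  g i = punchOut {i = y} {j = f i} (λ y≡fi → miss (i , sym y≡fi))
  g-inj : ∀ {i j} → g i ≡ g j → i ≡ j
  g-inj {i} {j} eq = f-inj i j (Fin.punchOut-injective {i = y} _ _ eq)

ReverseLayout : Graph → ℕ → Set
ReverseLayout G c = Σ (Fin (n G) → Fin (n G)) λ σ → Injective σ ×
  (∀ i → SuppAtMost G (σ i) (λ w → ∃[ j ] (i <ᶠ j × σ j ≡ w)) c)

reverse-layout : ∀ G {c} → ReverseLayout G c → EdgeAdmAtMost G c
reverse-layout G {c} (σ , σ-inj , σ-supp) = L , value
  where
  τ : Fin (n G) → Fin (n G)
  τ = σ ∘ opposite
  τ-inj : Injective τ
  τ-inj i j eq = trans (sym (Fin.opposite-involutive i))
                   (trans (cong opposite (σ-inj _ _ eq)) (Fin.opposite-involutive j))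
  τ-onto = injective⇒surjective τ τ-inj
  L : Layout G
  L = permutation τ (proj₁ ∘ τ-onto) (proj₂ ∘ τ-onto) (λ i → τ-inj _ _ (proj₂ (τ-onto (τ i))))
  opposite-< : ∀ {i j : Fin (n G)} → j <ᶠ i → opposite i <ᶠ opposite j
  opposite-< {i} {j} j<i = subst₂ _<_ (sym (Fin.opposite-prop i)) (sym (Fin.opposite-prop j))
                             (∸-monoʳ-< (s≤s j<i) (Fin.toℕ<n i))
  value : LayoutValueAtMost G L c
  value i with A , ∣A∣≤c , A-cuts ← σ-supp (opposite i) =
    A , ∣A∣≤c , λ { y (j , j<i , refl) → A-cuts y (opposite j , opposite-< j<i , refl) }

module Isolation (G : Graph) (k : ℕ) where
  open Cuts G

  IsolatingCut : VSet (n G) → Vertex → Set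
  IsolatingCut R v = Σ (VSet (n G)) λ Z →
    Z v ≡ true × (∀ y → R y ≡ true → Z y ≡ true → y ≡ v) × ∂ Z ≤ k

  IsolatedVertex : VSet (n G) → Set
  IsolatedVertex R = Σ Vertex λ v → R v ≡ true × IsolatingCut R v

  module _ (small-mincut : ∀ x y → x ≢ y → Σ (VSet (n G)) λ Z → MinCut x y Z × ∂ Z ≤ k) where

    shrink : ∀ R {x y Z} p → Acc _<_ (count (R ∩ Z)) → MinCut x y Z → ∂ Z ≤ k →
             R p ≡ true → Z p ≡ true → IsolatedVertex R
    shrink R {y = y} {Z} p (acc smaller) Zmin ∂Z≤k Rp Zp = step (singleton-or-other (R ∩ Z) p)
      where
      -- W separates a from b inside Z and misses y, so W ∩ Z is a minimum a–b cut with fewer points of R.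
      uncross : ∀ {a b W} → MinCut a b W → ∂ W ≤ k → W y ≡ false →
                R a ≡ true → Z a ≡ true → R b ≡ true → Z b ≡ true →
                IsolatedVertex R
      uncross {a} {b} {W} Wmin@(Wa , Wb , _) ∂W≤k Wy Ra Za Rb Zb =
        shrink R a (smaller (count-< ⊆-RZ b b∉ (∧-intro Rb Zb)))
          (MinCut-uncross Zmin Wmin Za Wy) (≤-trans (∂-∩-≤ W Zmin Wy) ∂W≤k) Ra (∧-intro Wa Za)
        where
        ⊆-RZ : (R ∩ (W ∩ Z)) ⊆ (R ∩ Z)
        ⊆-RZ v h with Rv , WZv ← ∧-elim {R v} h = ∧-intro Rv (proj₂ (∧-elim {W v} WZv))
        b∉ : R b ∧ (W b ∧ Z b) ≡ false
        b∉ rewrite Wb = ∧-zeroʳ (R b)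

      step : (∀ q → (R ∩ Z) q ≡ true → q ≡ p) ⊎ (Σ Vertex λ q → (R ∩ Z) q ≡ true × q ≢ p) →
             IsolatedVertex R
      step (inj₁ only-p) = p , Rp , Z , Zp , (λ q Rq Zq → only-p q (∧-intro Rq Zq)) , ∂Z≤k
      step (inj₂ (q , RZq , q≢p)) with ∧-elim RZq | small-mincut p q (q≢p ∘ sym)
      ... | Rq , Zq | W , Wmin , ∂W≤k with W y in Wy
      ...   | false = uncross Wmin ∂W≤k Wy Rp Zp Rq Zq
      ...   | true  = uncross (MinCut-∁ Wmin) (subst (_≤ k) (sym (∂-∁ W)) ∂W≤k) (cong not Wy) Rq Zq Rp Zp

    isolated-vertex : ∀ R r → R r ≡ true → IsolatedVertex R
    isolated-vertex R r Rr with singleton-or-other R r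
    ... | inj₁ only-r = r , Rr , (λ _ → true) , refl , (λ q Rq _ → only-r q Rq) , ∂-everything≤k
      where
      ∂-everything≤k : ∂ (λ _ → true) ≤ k
      ∂-everything≤k = subst (_≤ k) (sym (sum-zero (length (edges G)))) z≤n
    ... | inj₂ (q , Rq , q≢r) with small-mincut r q (q≢r ∘ sym)
    ...   | Z , Zmin@(Zr , _) , ∂Z≤k = shrink R r (<-wellFounded _) Zmin ∂Z≤k Rr Zr

    Peeling : VSet (n G) → ℕ → Set
    Peeling R m = Σ (Fin m → Vertex) λ σ → Injective σ × (∀ i → R (σ i) ≡ true) ×
      (∀ i → SuppAtMost G (σ i) (λ w → ∃[ j ] (i <ᶠ j × σ j ≡ w)) k)

    peel : ∀ {R m} v → R v ≡ true → IsolatingCut R v → Peeling (R - v) m → Peeling R (suc m)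
    peel {R} {m} v Rv (Z , Zv , Z∩R⊆v , ∂Z≤k) (σ , σ-inj , σ∈R-v , σ-supp) = σ′ , σ′-inj , σ′∈R , σ′-supp
      where
      σ≢v : ∀ i → σ i ≢ v
      σ≢v i = not-==⇒≢ (proj₂ (∧-elim {R (σ i)} (σ∈R-v i)))
      σ′ : Fin (suc m) → Vertex
      σ′ zero    = v
      σ′ (suc i) = σ i
      σ′-inj : Injective σ′
      σ′-inj zero    zero    _  = refl
      σ′-inj zero    (suc j) eq = contradiction (sym eq) (σ≢v j)
      σ′-inj (suc i) zero    eq = contradiction eq (σ≢v i)
      σ′-inj (suc i) (suc j) eq = cong suc (σ-inj i j eq)
      σ′∈R : ∀ i → R (σ′ i) ≡ true
      σ′∈R zero    = Rv
      σ′∈R (suc i) = proj₁ (∧-elim {R (σ i)} (σ∈R-v i))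
      σ′-supp : ∀ i → SuppAtMost G (σ′ i) (λ w → ∃[ j ] (i <ᶠ j × σ′ j ≡ w)) k
      σ′-supp zero = cut⇒SuppAtMost Z v _ k Zv later∉Z ∂Z≤k
        where
        later∉Z : ∀ y → ∃[ j ] (zero {m} <ᶠ j × σ′ j ≡ y) → Z y ≡ false
        later∉Z y (suc j , _ , refl) with Z (σ j) in Zσj
        ... | false = refl
        ... | true  = contradiction (Z∩R⊆v (σ j) (σ′∈R (suc j)) Zσj) (σ≢v j)
      σ′-supp (suc i) with A , ∣A∣≤k , A-cuts ← σ-supp i =
        A , ∣A∣≤k , λ { y (suc j , s≤s i<j , eq) → A-cuts y (j , i<j , eq) }

    peeling : ∀ m R → count R ≡ m → Peeling R m
    peeling zero    R _ = (λ ()) , (λ ()) , (λ ()) , (λ ())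
    peeling (suc m) R ∣R∣≡1+m
      with r , Rr ← count-witness R ∣R∣≡1+m
      with v , Rv , cut ← isolated-vertex R r Rr =
      peel v Rv cut (peeling m (R - v) (suc-injective (trans (sym (count-remove R v Rv)) ∣R∣≡1+m)))

    reverse-peeling : ReverseLayout G k
    reverse-peeling with σ , σ-inj , _ , σ-supp ← peeling (n G) (λ _ → true) (count-true (n G)) =
      σ , σ-inj , σ-supp

EdgeAdmAtMost-mono : ∀ {G c d} → c ≤ d → EdgeAdmAtMost G c → EdgeAdmAtMost G d
EdgeAdmAtMost-mono c≤d (L , value) = L , λ i → let A , ∣A∣≤c , A-cuts = value i in A , ≤-trans ∣A∣≤c c≤d , A-cuts

k≤2k∸1 : ∀ k → 1 ≤ k → k ≤ 2 * k ∸ 1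
k≤2k∸1 (suc k) _ = ≤-trans (s≤s (m≤m+n k (k + 0))) (≤-reflexive (sym (+-suc k (k + 0))))

lemma4 : (G : Graph) (k : ℕ) → 1 ≤ k →
         ¬ Immersion (θ (suc k)) G → EdgeAdmAtMost G (2 * k ∸ 1)
lemma4 G k 1≤k no-θ =
  EdgeAdmAtMost-mono (k≤2k∸1 k 1≤k)
    (reverse-layout G (Isolation.reverse-peeling G k (no-θ⇒small-mincut G k no-θ)))
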